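{- Let $M(A)$, $N(B)$, $P(C)$ be matroids, and let $U=A\cap(B\cup C)$ and $V=(A\cup B)\cap C$. (1) If $(M,N)$ and $(M\mathbin{\Join} N,P)$ are matched, then $(M\mathbin{\Join} N)\mathbin{\Join} P=M\mathbin{\Join}(N'\mathbin{\Join} P)$, where $N'=M.U\mathbin{\Join} N$. (2) If $(N,P)$ and $(M,N\mathbin{\Join} P)$ are matched, then $M\mathbin{\Join}(N\mathbin{\Join} P)=(M\mathbin{\Join} N'')\mathbin{\Join} P$, where $N''=N\mathbin{\Join} P|V$.
   Context: $K|X$ is restriction; $K.X$ is contraction of $K$ to $X$, i.e. $K/(E-X)$. Matroids $M(A)$, $N(B)$ are matched if $M.(A\cap B)=N|(A\cap B)$. Free splice $M\mathbin{\Join} N$ of matched $M(A)$, $N(B)$: matroid on $A\cup B$ with rank $r(X)=\min\{r_M(X\cap A)+|X-A|,\ r_N(X\cap B)+r_M(A-B)\}$. Unary operations bind before binary ones, so $N\mathbin{\Join} P|V$ means $N\mathbin{\Join}(P|V)$. -}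

module Defs where

open import Data.Nat using (ℕ; _+_; _∸_; _≤_; _⊓_)
open import Data.Fin.Subset using (Subset; _∪_; _∩_; _─_; _⊆_; ∣_∣)
open import Data.Product using (_×_)
open import Relation.Binary.PropositionalEquality using (_≡_)

-- A set function on a finite ground set E ⊆ Fin n (the common universe
-- containing all ground sets involved).  Only the values of rk on
-- subsets of E are meaningful.
record SetFn (n : ℕ) : Set where
  constructor mkSetFn
  field
    ground : Subset n
    rk     : Subset n → ℕ
open SetFn public

record IsMatroid {n : ℕ} (M : SetFn n) : Set where
  field
    bounded    : ∀ X → X ⊆ ground M → rk M X ≤ ∣ X ∣
    monotone   : ∀ X Y → Y ⊆ ground M → X ⊆ Y → rk M X ≤ rk M Y
    submodular : ∀ X Y → X ⊆ ground M → Y ⊆ ground M →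
                 rk M (X ∪ Y) + rk M (X ∩ Y) ≤ rk M X + rk M Y

infix 4 _≅_
_≅_ : {n : ℕ} → SetFn n → SetFn n → Set
M ≅ N = (ground M ≡ ground N) × (∀ X → X ⊆ ground M → rk M X ≡ rk N X)

infixl 9 _∣_
_∣_ : {n : ℕ} → SetFn n → Subset n → SetFn n
K ∣ X = mkSetFn (X ∩ ground K) (rk K)

-- Contraction K.X = K/(E - X) (ground X ∩ E).
infixl 9 _∙_
_∙_ : {n : ℕ} → SetFn n → Subset n → SetFn n
K ∙ X = mkSetFn (X ∩ ground K)
                (λ Y → rk K (Y ∪ (ground K ─ X)) ∸ rk K (ground K ─ X))

Matched : {n : ℕ} → SetFn n → SetFn n → Set
Matched M N = M ∙ (ground M ∩ ground N) ≅ N ∣ (ground M ∩ ground N)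

infixl 6 _⋈_
_⋈_ : {n : ℕ} → SetFn n → SetFn n → SetFn n
M ⋈ N = mkSetFn (A ∪ B)
  (λ X → (rk M (X ∩ A) + ∣ X ─ A ∣) ⊓ (rk N (X ∩ B) + rk M (A ─ B)))
  where
    A = ground M
    B = ground N

-- A free splice has an explicit min-plus rank function, so both identities are computations.
-- Unfolding the two rank functions at a subset X of the common ground set, every set that occurs
-- is a Boolean combination of X, A, B, C (such identities are decided by truth tables), and once
-- the rank rk M (A ─ U) subtracted by the contraction is added back, the two sides are minima of
-- the same terms up to terms that are dominated.  In (1) the extra term is dominated by
-- monotonicity of rk M.  In (2) one extra term is dominated because rk P grows by at most one per
-- element, the other by rk M (A ─ (B ∪ C)) + rk N (B ─ C) ≤ rk M (A ─ C) + ∣B ─ C ─ A∣, which is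
-- where the matching of M with N ⋈ P is used.
module Submission where

open import Defs
open import Data.Bool using (Bool; false; _∧_; _∨_; not)
open import Data.Bool.Properties using (_≟_)
open import Data.Fin using (Fin; zero; suc)
open import Data.Fin.Subset using (Subset; _∪_; _∩_; _─_; _⊆_; ∣_∣; ⊥; inside; outside)
open import Data.Fin.Subset.Properties
  using (anySubset?; ⊆-antisym; ⊆-trans; ⊆-min; p∩q⊆p; p∩q⊆q; x∈p∩q⁺; x∈p∪q⁻; q⊆p∪q; p─q⊆p;
         p⊆q⇒∣p∣≤∣q∣; ∣⊥∣≡0)
open import Data.Nat using (ℕ; suc; _+_; _≤_; _⊓_)
open import Data.Nat.Properties
  using (n≤0⇒n≡0; ≤-trans; ≤-reflexive; m≤m+n; +-monoʳ-≤; +-monoˡ-≤; m∸n+n≡m; +-assoc; +-comm; +-suc;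
         +-identityʳ; +-distribʳ-⊓; ⊓-assoc; ⊓-idem; m≤n⇒m⊓n≡m; m≥n⇒m⊓n≡n; +-commutativeSemigroup;
         module ≤-Reasoning)
open import Algebra.Properties.CommutativeSemigroup +-commutativeSemigroup using (xy∙z≈xz∙y)
open import Data.Product using (_×_; ∃; _,_; proj₂)
open import Data.Sum using ([_,_]′)
open import Data.Vec using (Vec; []; _∷_; lookup; map; tabulate)
open import Data.Vec.Properties
  using (lookup-map; lookup-zipWith; lookup-replicate; tabulate∘lookup; tabulate-cong)
open import Function using (_∘_)
open import Relation.Binary.PropositionalEquality
  using (_≡_; _≢_; refl; sym; trans; cong; cong₂; subst; module ≡-Reasoning)
open import Relation.Nullary.Decidable using (Dec; False; ¬?; toWitnessFalse; decidable-stable)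

private variable k n : ℕ

-- Boolean combinations of subsets

infixr 7 _∩′_
infixr 6 _∪′_
infixl 5 _─′_

data SetExpr (k : ℕ) : Set where
  var            : Fin k → SetExpr k
  ∅′             : SetExpr k
  _∪′_ _∩′_ _─′_ : SetExpr k → SetExpr k → SetExpr k

⟦_⟧ : SetExpr k → Vec (Subset n) k → Subset n
⟦ var i  ⟧ ρ = lookup ρ i
⟦ ∅′     ⟧ ρ = ⊥
⟦ l ∪′ r ⟧ ρ = ⟦ l ⟧ ρ ∪ ⟦ r ⟧ ρ
⟦ l ∩′ r ⟧ ρ = ⟦ l ⟧ ρ ∩ ⟦ r ⟧ ρ
⟦ l ─′ r ⟧ ρ = ⟦ l ⟧ ρ ─ ⟦ r ⟧ ρ

⟦_⟧ᵇ : SetExpr k → Vec Bool k → Bool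
⟦ var i  ⟧ᵇ β = lookup β i
⟦ ∅′     ⟧ᵇ β = false
⟦ l ∪′ r ⟧ᵇ β = ⟦ l ⟧ᵇ β ∨ ⟦ r ⟧ᵇ β
⟦ l ∩′ r ⟧ᵇ β = ⟦ l ⟧ᵇ β ∧ ⟦ r ⟧ᵇ β
⟦ l ─′ r ⟧ᵇ β = ⟦ l ⟧ᵇ β ∧ not (⟦ r ⟧ᵇ β)

lookup-─ : ∀ (p q : Subset n) i → lookup (p ─ q) i ≡ lookup p i ∧ not (lookup q i)
lookup-─ (inside  ∷ p) (inside  ∷ q) zero    = refl
lookup-─ (inside  ∷ p) (outside ∷ q) zero    = refl
lookup-─ (outside ∷ p) (inside  ∷ q) zero    = refl
lookup-─ (outside ∷ p) (outside ∷ q) zero    = refl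
lookup-─ (_       ∷ p) (_       ∷ q) (suc i) = lookup-─ p q i

lookup-⟦⟧ : ∀ (e : SetExpr k) (ρ : Vec (Subset n) k) i →
            lookup (⟦ e ⟧ ρ) i ≡ ⟦ e ⟧ᵇ (map (λ p → lookup p i) ρ)
lookup-⟦⟧ (var j)  ρ i = sym (lookup-map j (λ p → lookup p i) ρ)
lookup-⟦⟧ ∅′       ρ i = lookup-replicate i false
lookup-⟦⟧ (l ∪′ r) ρ i =
  trans (lookup-zipWith _∨_ i (⟦ l ⟧ ρ) (⟦ r ⟧ ρ)) (cong₂ _∨_ (lookup-⟦⟧ l ρ i) (lookup-⟦⟧ r ρ i))
lookup-⟦⟧ (l ∩′ r) ρ i =
  trans (lookup-zipWith _∧_ i (⟦ l ⟧ ρ) (⟦ r ⟧ ρ)) (cong₂ _∧_ (lookup-⟦⟧ l ρ i) (lookup-⟦⟧ r ρ i))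
lookup-⟦⟧ (l ─′ r) ρ i =
  trans (lookup-─ (⟦ l ⟧ ρ) (⟦ r ⟧ ρ) i) (cong₂ (λ u v → u ∧ not v) (lookup-⟦⟧ l ρ i) (lookup-⟦⟧ r ρ i))

counterexample? : (l r : SetExpr k) → Dec (∃ λ β → ⟦ l ⟧ᵇ β ≢ ⟦ r ⟧ᵇ β)
counterexample? l r = anySubset? (λ β → ¬? (⟦ l ⟧ᵇ β ≟ ⟦ r ⟧ᵇ β))

-- A set identity holds for all subsets as soon as it holds in the two-element
-- algebra, which the implicit argument checks by a truth table.
solve : (l r : SetExpr k) → {False (counterexample? l r)} →
        (ρ : Vec (Subset n) k) → ⟦ l ⟧ ρ ≡ ⟦ r ⟧ ρ
solve l r {valid} ρ = begin
  ⟦ l ⟧ ρ                     ≡⟨ tabulate∘lookup (⟦ l ⟧ ρ) ⟨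
  tabulate (lookup (⟦ l ⟧ ρ)) ≡⟨ tabulate-cong pointwise ⟩
  tabulate (lookup (⟦ r ⟧ ρ)) ≡⟨ tabulate∘lookup (⟦ r ⟧ ρ) ⟩
  ⟦ r ⟧ ρ                     ∎
  where
  open ≡-Reasoning
  agree : ∀ β → ⟦ l ⟧ᵇ β ≡ ⟦ r ⟧ᵇ β
  agree β = decidable-stable (⟦ l ⟧ᵇ β ≟ ⟦ r ⟧ᵇ β) (λ l≢r → toWitnessFalse valid (β , l≢r))
  pointwise : ∀ i → lookup (⟦ l ⟧ ρ) i ≡ lookup (⟦ r ⟧ ρ) i
  pointwise i = trans (lookup-⟦⟧ l ρ i) (trans (agree _) (sym (lookup-⟦⟧ r ρ i)))

a : SetExpr (suc k)
a = var zero

b : SetExpr (suc (suc k))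
b = var (suc zero)

c : SetExpr (suc (suc (suc k)))
c = var (suc (suc zero))

y : SetExpr 4
y = var (suc (suc (suc zero)))

module Venn (ρ : Vec (Subset n) k) where

  ⟪_⟫ : SetExpr k → Subset n
  ⟪ e ⟫ = ⟦ e ⟧ ρ

  infix 4 _≐_
  _≐_ : (l r : SetExpr k) → {False (counterexample? l r)} → ⟪ l ⟫ ≡ ⟪ r ⟫
  (l ≐ r) {valid} = solve l r {valid} ρ

  ⊆-by : (l r : SetExpr k) → {False (counterexample? l (l ∩′ r))} → ⟪ l ⟫ ⊆ ⟪ r ⟫
  ⊆-by l r {valid} = subst (_⊆ ⟪ r ⟫) (sym (solve l (l ∩′ r) {valid} ρ)) (p∩q⊆q ⟪ l ⟫ ⟪ r ⟫)

∪-least : {p q r : Subset n} → p ⊆ r → q ⊆ r → p ∪ q ⊆ r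
∪-least {p = p} {q} p⊆r q⊆r = [ p⊆r , q⊆r ]′ ∘ x∈p∪q⁻ p q

⊆⇒∩≡ : {p q : Subset n} → p ⊆ q → p ∩ q ≡ p
⊆⇒∩≡ {p = p} {q} p⊆q = ⊆-antisym (p∩q⊆p p q) (λ x∈p → x∈p∩q⁺ (x∈p , p⊆q x∈p))

∣p∣≡∣p∩q∣+∣p─q∣ : ∀ (p q : Subset n) → ∣ p ∣ ≡ ∣ p ∩ q ∣ + ∣ p ─ q ∣
∣p∣≡∣p∩q∣+∣p─q∣ []            []            = refl
∣p∣≡∣p∩q∣+∣p─q∣ (inside  ∷ p) (inside  ∷ q) = cong suc (∣p∣≡∣p∩q∣+∣p─q∣ p q)
∣p∣≡∣p∩q∣+∣p─q∣ (inside  ∷ p) (outside ∷ q) = trans (cong suc (∣p∣≡∣p∩q∣+∣p─q∣ p q)) (sym (+-suc _ _))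
∣p∣≡∣p∩q∣+∣p─q∣ (outside ∷ p) (inside  ∷ q) = ∣p∣≡∣p∩q∣+∣p─q∣ p q
∣p∣≡∣p∩q∣+∣p─q∣ (outside ∷ p) (outside ∷ q) = ∣p∣≡∣p∩q∣+∣p─q∣ p q

-- Ranks of matroids, contractions and free splices

module _ {K : SetFn n} (K-matroid : IsMatroid K) where
  open IsMatroid K-matroid

  rk-⊥ : rk K ⊥ ≡ 0
  rk-⊥ = n≤0⇒n≡0 (≤-trans (bounded ⊥ (⊆-min (ground K))) (≤-reflexive (∣⊥∣≡0 n)))

  rk[S∪T]≤rk[S]+∣T∣ : {S T : Subset n} → S ⊆ ground K → T ⊆ ground K → rk K (S ∪ T) ≤ rk K S + ∣ T ∣
  rk[S∪T]≤rk[S]+∣T∣ {S} {T} S⊆E T⊆E = begin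
    rk K (S ∪ T)                ≤⟨ m≤m+n _ _ ⟩
    rk K (S ∪ T) + rk K (S ∩ T) ≤⟨ submodular S T S⊆E T⊆E ⟩
    rk K S + rk K T             ≤⟨ +-monoʳ-≤ (rk K S) (bounded T T⊆E) ⟩
    rk K S + ∣ T ∣              ∎
    where open ≤-Reasoning

≅-intro : {K L : SetFn n} → ground K ≡ ground L →
          (∀ Y → rk K (Y ∩ ground K) ≡ rk L (Y ∩ ground K)) → K ≅ L
≅-intro {K = K} {L} ground-eq rk-eq =
  ground-eq , λ X X⊆E → subst (λ Z → rk K Z ≡ rk L Z) (⊆⇒∩≡ X⊆E) (rk-eq X)

-- Monotonicity makes the truncated subtraction in the contraction exact.
∙-rk+ : {M : SetFn n} → IsMatroid M → ∀ U {Y} → Y ⊆ ground M →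
        rk (M ∙ U) Y + rk M (ground M ─ U) ≡ rk M (Y ∪ (ground M ─ U))
∙-rk+ {M = M} M-matroid U {Y} Y⊆A =
  m∸n+n≡m (IsMatroid.monotone M-matroid (A ─ U) (Y ∪ (A ─ U))
             (∪-least Y⊆A (p─q⊆p A U)) (q⊆p∪q Y (A ─ U)))
  where A = ground M

⋈-rk+ : ∀ (K L : SetFn n) X m →
        rk (K ⋈ L) X + m
        ≡ ((rk K (X ∩ ground K) + m) + ∣ X ─ ground K ∣)
          ⊓ (rk L (X ∩ ground L) + (rk K (ground K ─ ground L) + m))
⋈-rk+ K L X m =
  trans (+-distribʳ-⊓ m _ _)
        (cong₂ _⊓_ (xy∙z≈xz∙y (rk K (X ∩ ground K)) _ m) (+-assoc (rk L (X ∩ ground L)) _ m))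

∙⋈-rk+ : {M : SetFn n} → IsMatroid M → ∀ U (N : SetFn n) Z →
         rk (M ∙ U ⋈ N) Z + rk M (ground M ─ U)
         ≡ (rk M ((Z ∩ (U ∩ ground M)) ∪ (ground M ─ U)) + ∣ Z ─ (U ∩ ground M) ∣)
           ⊓ (rk N (Z ∩ ground N) + rk M (((U ∩ ground M) ─ ground N) ∪ (ground M ─ U)))
∙⋈-rk+ {M = M} M-matroid U N Z =
  trans (⋈-rk+ (M ∙ U) N Z (rk M (A ─ U)))
        (cong₂ _⊓_ (cong (_+ ∣ Z ─ (U ∩ A) ∣) (∙-rk+ M-matroid U (⊆-trans (p∩q⊆q _ _) (p∩q⊆q U A))))
                   (cong (rk N (Z ∩ ground N) +_) (∙-rk+ M-matroid U (⊆-trans (p─q⊆p _ _) (p∩q⊆q U A)))))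
  where A = ground M

matched-rk : {M J : SetFn n} → IsMatroid M → Matched M J → ∀ {Z} → Z ⊆ ground M ∩ ground J →
             rk M (Z ∪ (ground M ─ (ground M ∩ ground J))) ≡ rk M (ground M ─ (ground M ∩ ground J)) + rk J Z
matched-rk {M = M} {J} M-matroid matched {Z} Z⊆U = begin
  rk M (Z ∪ (A ─ U))          ≡⟨ ∙-rk+ M-matroid U (⊆-trans Z⊆U (p∩q⊆p A (ground J))) ⟨
  rk (M ∙ U) Z + rk M (A ─ U) ≡⟨ cong (_+ rk M (A ─ U)) (proj₂ matched Z Z⊆U∩A) ⟩
  rk J Z + rk M (A ─ U)       ≡⟨ +-comm (rk J Z) _ ⟩
  rk M (A ─ U) + rk J Z       ∎
  where
  open ≡-Reasoning
  A = ground M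
  U = A ∩ ground J
  Z⊆U∩A : Z ⊆ U ∩ A
  Z⊆U∩A z∈Z = x∈p∩q⁺ (Z⊆U z∈Z , p∩q⊆p A (ground J) (Z⊆U z∈Z))

-- Min-plus arithmetic

m≤n⇒m⊓[n⊓o]≡m⊓o : ∀ {m n} o → m ≤ n → m ⊓ (n ⊓ o) ≡ m ⊓ o
m≤n⇒m⊓[n⊓o]≡m⊓o {m} {n} o m≤n = trans (sym (⊓-assoc m n o)) (cong (_⊓ o) (m≤n⇒m⊓n≡m m≤n))

o≤n⇒[m⊓n]⊓o≡m⊓o : ∀ m {n o} → o ≤ n → (m ⊓ n) ⊓ o ≡ m ⊓ o
o≤n⇒[m⊓n]⊓o≡m⊓o m {n} {o} o≤n = trans (⊓-assoc m n o) (cong (m ⊓_) (m≥n⇒m⊓n≡n o≤n))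

min-plus-absorb : ∀ {α α′} d₁ s d₂ t → α ≤ α′ →
  (((α + d₁) ⊓ s) + d₂) ⊓ t ≡ (α + (d₁ + d₂)) ⊓ ((((α′ + d₁) ⊓ s) + d₂) ⊓ t)
min-plus-absorb {α} {α′} d₁ s d₂ t α≤α′ = begin
  (((α + d₁) ⊓ s) + d₂) ⊓ t
    ≡⟨ cong (_⊓ t) (+-distribʳ-⊓ d₂ _ s) ⟩
  ((α + d₁ + d₂) ⊓ (s + d₂)) ⊓ t
    ≡⟨ ⊓-assoc _ _ t ⟩
  (α + d₁ + d₂) ⊓ ((s + d₂) ⊓ t)
    ≡⟨ m≤n⇒m⊓[n⊓o]≡m⊓o _ (+-monoˡ-≤ d₂ (+-monoˡ-≤ d₁ α≤α′)) ⟨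
  (α + d₁ + d₂) ⊓ ((α′ + d₁ + d₂) ⊓ ((s + d₂) ⊓ t))
    ≡⟨ cong₂ _⊓_ (+-assoc α d₁ d₂) (sym (⊓-assoc _ _ t)) ⟩
  (α + (d₁ + d₂)) ⊓ (((α′ + d₁ + d₂) ⊓ (s + d₂)) ⊓ t)
    ≡⟨ cong (λ w → (α + (d₁ + d₂)) ⊓ (w ⊓ t)) (+-distribʳ-⊓ d₂ _ s) ⟨
  (α + (d₁ + d₂)) ⊓ ((((α′ + d₁) ⊓ s) + d₂) ⊓ t) ∎
  where open ≡-Reasoning

min-plus-reassoc : ∀ {π π′ μ ν γ e} α f₁ β f₂ f₃ → π ≤ π′ + f₃ → μ + ν ≤ γ + e →
  (α + (f₁ + f₃)) ⊓ (((β + (f₂ + f₃)) ⊓ (π + ν)) + μ)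
  ≡ (((α + f₁) ⊓ (((β + f₂) ⊓ (π′ + ν)) + μ)) + f₃) ⊓ (π + ((γ + e) ⊓ (ν + μ)))
min-plus-reassoc {π} {π′} {μ} {ν} {γ} {e} α f₁ β f₂ f₃ π≤π′+f₃ μ+ν≤γ+e = sym (begin
  (((α + f₁) ⊓ (((β + f₂) ⊓ (π′ + ν)) + μ)) + f₃) ⊓ (π + ((γ + e) ⊓ (ν + μ)))
    ≡⟨ cong₂ _⊓_ (+-distribʳ-⊓ f₃ _ _) (cong (π +_) (m≥n⇒m⊓n≡n ν+μ≤γ+e)) ⟩
  (α + f₁ + f₃) ⊓ ((((β + f₂) ⊓ (π′ + ν)) + μ) + f₃) ⊓ (π + (ν + μ))
    ≡⟨ cong₂ (λ u w → (α + f₁ + f₃) ⊓ u ⊓ w) push-f₃ (sym (+-assoc π ν μ)) ⟩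
  (α + f₁ + f₃) ⊓ (((β + f₂ + f₃) ⊓ (π′ + ν + f₃)) + μ) ⊓ ((π + ν) + μ)
    ≡⟨ ⊓-assoc _ _ _ ⟩
  (α + f₁ + f₃) ⊓ ((((β + f₂ + f₃) ⊓ (π′ + ν + f₃)) + μ) ⊓ ((π + ν) + μ))
    ≡⟨ cong ((α + f₁ + f₃) ⊓_) (+-distribʳ-⊓ μ _ _) ⟨
  (α + f₁ + f₃) ⊓ ((((β + f₂ + f₃) ⊓ (π′ + ν + f₃)) ⊓ (π + ν)) + μ)
    ≡⟨ cong (λ w → (α + f₁ + f₃) ⊓ (w + μ)) (o≤n⇒[m⊓n]⊓o≡m⊓o _ π+ν≤π′+ν+f₃) ⟩
  (α + f₁ + f₃) ⊓ (((β + f₂ + f₃) ⊓ (π + ν)) + μ)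
    ≡⟨ cong₂ (λ u w → u ⊓ ((w ⊓ (π + ν)) + μ)) (+-assoc α f₁ f₃) (+-assoc β f₂ f₃) ⟩
  (α + (f₁ + f₃)) ⊓ (((β + (f₂ + f₃)) ⊓ (π + ν)) + μ) ∎)
  where
  open ≡-Reasoning
  ν+μ≤γ+e : ν + μ ≤ γ + e
  ν+μ≤γ+e = ≤-trans (≤-reflexive (+-comm ν μ)) μ+ν≤γ+e
  π+ν≤π′+ν+f₃ : π + ν ≤ π′ + ν + f₃
  π+ν≤π′+ν+f₃ = ≤-trans (+-monoˡ-≤ ν π≤π′+f₃) (≤-reflexive (xy∙z≈xz∙y π′ f₃ ν))
  push-f₃ : (((β + f₂) ⊓ (π′ + ν)) + μ) + f₃ ≡ ((β + f₂ + f₃) ⊓ (π′ + ν + f₃)) + μ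
  push-f₃ = trans (xy∙z≈xz∙y _ μ f₃) (cong (_+ μ) (+-distribʳ-⊓ f₃ _ _))

-- The two associativity laws

module SpliceAssocˡ (M N P : SetFn n) (M-matroid : IsMatroid M) where
  open IsMatroid M-matroid

  A B C U : Subset n
  A = ground M
  B = ground N
  C = ground P
  U = A ∩ (B ∪ C)

  K N′ Q : SetFn n
  K = M ⋈ N
  N′ = M ∙ U ⋈ N
  Q = N′ ⋈ P

  u g′ : SetExpr (3 + k)
  u = a ∩′ (b ∪′ c)
  g′ = u ∩′ a ∪′ b

  ground-eq : ground (K ⋈ P) ≡ ground (M ⋈ Q)
  ground-eq = (a ∪′ b) ∪′ c ≐ a ∪′ (g′ ∪′ c)
    where open Venn (A ∷ B ∷ C ∷ [])

  rk-eq : ∀ Y → rk (K ⋈ P) (Y ∩ ground (K ⋈ P)) ≡ rk (M ⋈ Q) (Y ∩ ground (K ⋈ P))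
  rk-eq Y = begin
    rk (K ⋈ P) ⟪ x ⟫
      ≡⟨ min-plus-absorb d₁ βμ d₂ πκ α≤α′ ⟩
    (α + (d₁ + d₂)) ⊓ ((((α′ + d₁) ⊓ βμ) + d₂) ⊓ πκ)
      ≡⟨ cong₂ _⊓_ (cong₂ _+_ (cong (rk M) (x ∩′ a ≐ xᴷ ∩′ a)) ∣X─A∣) Q-eq ⟨
    rk (M ⋈ Q) ⟪ x ⟫ ∎
    where
    open ≡-Reasoning
    open Venn (A ∷ B ∷ C ∷ Y ∷ [])

    x xᴷ x″ z : SetExpr 4
    x = y ∩′ ((a ∪′ b) ∪′ c)
    xᴷ = x ∩′ (a ∪′ b)
    x″ = x ∩′ (g′ ∪′ c)
    z = x″ ∩′ g′

    m α α′ d₁ d₂ βμ πκ : ℕ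
    m = rk M ⟪ a ─′ u ⟫
    α = rk M ⟪ xᴷ ∩′ a ⟫
    α′ = rk M ⟪ (z ∩′ (u ∩′ a)) ∪′ (a ─′ u) ⟫
    d₁ = ∣ ⟪ xᴷ ─′ a ⟫ ∣
    d₂ = ∣ ⟪ x ─′ (a ∪′ b) ⟫ ∣
    βμ = rk N ⟪ xᴷ ∩′ b ⟫ + rk M ⟪ a ─′ b ⟫
    πκ = rk P ⟪ x ∩′ c ⟫ + rk K ⟪ (a ∪′ b) ─′ c ⟫

    α≤α′ : α ≤ α′
    α≤α′ = monotone _ _ (⊆-by ((z ∩′ (u ∩′ a)) ∪′ (a ─′ u)) a)
                        (⊆-by (xᴷ ∩′ a) ((z ∩′ (u ∩′ a)) ∪′ (a ─′ u)))

    ∣X─A∣ : ∣ ⟪ x ─′ a ⟫ ∣ ≡ d₁ + d₂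
    ∣X─A∣ = trans (∣p∣≡∣p∩q∣+∣p─q∣ ⟪ x ─′ a ⟫ ⟪ a ∪′ b ⟫)
                  (cong₂ _+_ (cong ∣_∣ ((x ─′ a) ∩′ (a ∪′ b) ≐ xᴷ ─′ a))
                             (cong ∣_∣ (x ─′ a ─′ (a ∪′ b) ≐ x ─′ (a ∪′ b))))

    μ-eq : rk M ⟪ ((u ∩′ a) ─′ b) ∪′ (a ─′ u) ⟫ ≡ rk M ⟪ a ─′ b ⟫
    μ-eq = cong (rk M) (((u ∩′ a) ─′ b) ∪′ (a ─′ u) ≐ a ─′ b)

    N′-at-X : rk N′ ⟪ z ⟫ + m ≡ (α′ + d₁) ⊓ βμ
    N′-at-X = trans (∙⋈-rk+ M-matroid U N ⟪ z ⟫)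
      (cong₂ _⊓_ (cong (α′ +_) (cong ∣_∣ (z ─′ (u ∩′ a) ≐ xᴷ ─′ a)))
                 (cong₂ _+_ (cong (rk N) (z ∩′ b ≐ xᴷ ∩′ b)) μ-eq))

    N′-off-C : rk N′ ⟪ g′ ─′ c ⟫ + m ≡ rk K ⟪ (a ∪′ b) ─′ c ⟫
    N′-off-C = trans (∙⋈-rk+ M-matroid U N ⟪ g′ ─′ c ⟫)
      (cong₂ _⊓_ (cong₂ _+_ (cong (rk M) (((g′ ─′ c) ∩′ (u ∩′ a)) ∪′ (a ─′ u) ≐ ((a ∪′ b) ─′ c) ∩′ a))
                            (cong ∣_∣ ((g′ ─′ c) ─′ (u ∩′ a) ≐ (a ∪′ b) ─′ c ─′ a)))
                 (cong₂ _+_ (cong (rk N) ((g′ ─′ c) ∩′ b ≐ ((a ∪′ b) ─′ c) ∩′ b)) μ-eq))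

    Q-eq : rk Q ⟪ x″ ⟫ + rk M ⟪ a ─′ (g′ ∪′ c) ⟫ ≡ (((α′ + d₁) ⊓ βμ) + d₂) ⊓ πκ
    Q-eq = begin
      rk Q ⟪ x″ ⟫ + rk M ⟪ a ─′ (g′ ∪′ c) ⟫
        ≡⟨ cong (λ S → rk Q ⟪ x″ ⟫ + rk M S) (a ─′ (g′ ∪′ c) ≐ a ─′ u) ⟩
      rk Q ⟪ x″ ⟫ + m
        ≡⟨ ⋈-rk+ N′ P ⟪ x″ ⟫ m ⟩
      ((rk N′ ⟪ z ⟫ + m) + ∣ ⟪ x″ ─′ g′ ⟫ ∣) ⊓ (rk P ⟪ x″ ∩′ c ⟫ + (rk N′ ⟪ g′ ─′ c ⟫ + m))
        ≡⟨ cong₂ _⊓_ (cong₂ _+_ N′-at-X (cong ∣_∣ (x″ ─′ g′ ≐ x ─′ (a ∪′ b))))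
                     (cong₂ _+_ (cong (rk P) (x″ ∩′ c ≐ x ∩′ c)) N′-off-C) ⟩
      (((α′ + d₁) ⊓ βμ) + d₂) ⊓ πκ ∎

  splice-assoc : K ⋈ P ≅ M ⋈ Q
  splice-assoc = ≅-intro ground-eq rk-eq

module SpliceAssocʳ (M N P : SetFn n) (M-matroid : IsMatroid M) (N-matroid : IsMatroid N)
                    (P-matroid : IsMatroid P) (matched : Matched M (N ⋈ P)) where

  A B C V : Subset n
  A = ground M
  B = ground N
  C = ground P
  V = (A ∪ B) ∩ C

  J S : SetFn n
  J = N ⋈ P
  S = M ⋈ (N ⋈ (P ∣ V))

  v gn gs : SetExpr (3 + k)
  v = (a ∪′ b) ∩′ c
  gn = b ∪′ v ∩′ c
  gs = a ∪′ gn

  ground-eq : ground (M ⋈ J) ≡ ground (S ⋈ P)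
  ground-eq = a ∪′ (b ∪′ c) ≐ gs ∪′ c
    where open Venn (A ∷ B ∷ C ∷ [])

  -- Matching computes rk M (A ─ C) as rk M (A ─ (B ∪ C)) + rk N (A ∩ B ─ C).
  matched-bound : rk M (A ─ (B ∪ C)) + rk N (B ─ C) ≤ rk M (A ─ C) + ∣ B ─ C ─ A ∣
  matched-bound = begin
    μ + ν       ≤⟨ +-monoʳ-≤ μ ν≤q+e ⟩
    μ + (q + e) ≡⟨ +-assoc μ q e ⟨
    μ + q + e   ≡⟨ cong (_+ e) γ≡μ+q ⟨
    γ + e       ∎
    where
    open ≤-Reasoning
    open Venn (A ∷ B ∷ C ∷ [])

    z : SetExpr 3
    z = (a ∩′ b) ─′ c

    μ ν γ q e : ℕ
    μ = rk M ⟪ a ─′ (b ∪′ c) ⟫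
    ν = rk N ⟪ b ─′ c ⟫
    γ = rk M ⟪ a ─′ c ⟫
    q = rk N ⟪ z ∩′ b ⟫
    e = ∣ ⟪ b ─′ c ─′ a ⟫ ∣

    q≤ν : q ≤ ν
    q≤ν = IsMatroid.monotone N-matroid _ _ (⊆-by (b ─′ c) b) (⊆-by (z ∩′ b) (b ─′ c))

    ν≤q+e : ν ≤ q + e
    ν≤q+e = begin
      ν                                   ≡⟨ cong (rk N) (b ─′ c ≐ (z ∩′ b) ∪′ (b ─′ c ─′ a)) ⟩
      rk N ⟪ (z ∩′ b) ∪′ (b ─′ c ─′ a) ⟫ ≤⟨ rk[S∪T]≤rk[S]+∣T∣ N-matroid (⊆-by (z ∩′ b) b) (⊆-by (b ─′ c ─′ a) b) ⟩
      q + e                               ∎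

    J-at-z : rk J ⟪ z ⟫ ≡ q
    J-at-z = begin-equality
      rk J ⟪ z ⟫                 ≡⟨ cong₂ (λ s t → (q + ∣ s ∣) ⊓ (rk P t + ν)) (z ─′ b ≐ ∅′) (z ∩′ c ≐ ∅′) ⟩
      (q + ∣ ⊥ {n} ∣) ⊓ (rk P ⊥ + ν) ≡⟨ cong₂ (λ s t → (q + s) ⊓ (t + ν)) (∣⊥∣≡0 n) (rk-⊥ P-matroid) ⟩
      (q + 0) ⊓ ν                ≡⟨ cong (_⊓ ν) (+-identityʳ q) ⟩
      q ⊓ ν                      ≡⟨ m≤n⇒m⊓n≡m q≤ν ⟩
      q                          ∎

    γ≡μ+q : γ ≡ μ + q
    γ≡μ+q = begin-equality
      γ                                        ≡⟨ cong (rk M) (a ─′ c ≐ z ∪′ (a ─′ a ∩′ (b ∪′ c))) ⟩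
      rk M ⟪ z ∪′ (a ─′ a ∩′ (b ∪′ c)) ⟫      ≡⟨ matched-rk M-matroid matched (⊆-by z (a ∩′ (b ∪′ c))) ⟩
      rk M ⟪ a ─′ a ∩′ (b ∪′ c) ⟫ + rk J ⟪ z ⟫ ≡⟨ cong₂ _+_ (cong (rk M) (a ─′ a ∩′ (b ∪′ c) ≐ a ─′ (b ∪′ c))) J-at-z ⟩
      μ + q                                    ∎

  rk-eq : ∀ Y → rk (M ⋈ J) (Y ∩ ground (M ⋈ J)) ≡ rk (S ⋈ P) (Y ∩ ground (M ⋈ J))
  rk-eq Y = begin-equality
    rk (M ⋈ J) ⟪ x ⟫
      ≡⟨ cong₂ (λ s t → (α + s) ⊓ (((β + t) ⊓ (π + ν)) + μ)) ∣X─A∣ ∣Xᴶ─B∣ ⟩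
    (α + (f₁ + f₃)) ⊓ (((β + (f₂ + f₃)) ⊓ (π + ν)) + μ)
      ≡⟨ min-plus-reassoc {γ = γ} {e} α f₁ β f₂ f₃ π≤π′+f₃ matched-bound ⟩
    (((α + f₁) ⊓ (((β + f₂) ⊓ (π′ + ν)) + μ)) + f₃) ⊓ (π + ((γ + e) ⊓ (ν + μ)))
      ≡⟨ cong₂ (λ s t → (s + f₃) ⊓ t) S-at-X (cong₂ _+_ (cong (rk P) (x ∩′ c ≐ xᴶ ∩′ c)) S-off-C) ⟨
    rk (S ⋈ P) ⟪ x ⟫ ∎
    where
    open ≤-Reasoning
    open Venn (A ∷ B ∷ C ∷ Y ∷ [])

    x xᴶ xˢ xᴺ w : SetExpr 4
    x = y ∩′ (a ∪′ (b ∪′ c))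
    xᴶ = x ∩′ (b ∪′ c)
    xˢ = x ∩′ gs
    xᴺ = xˢ ∩′ gn
    w = gs ─′ c

    α β π π′ ν μ γ e f₁ f₂ f₃ : ℕ
    α = rk M ⟪ x ∩′ a ⟫
    β = rk N ⟪ xᴶ ∩′ b ⟫
    π = rk P ⟪ xᴶ ∩′ c ⟫
    π′ = rk P ⟪ xᴺ ∩′ (v ∩′ c) ⟫
    ν = rk N ⟪ b ─′ c ⟫
    μ = rk M ⟪ a ─′ (b ∪′ c) ⟫
    γ = rk M ⟪ a ─′ c ⟫
    e = ∣ ⟪ b ─′ c ─′ a ⟫ ∣
    f₁ = ∣ ⟪ xˢ ─′ a ⟫ ∣
    f₂ = ∣ ⟪ xᴺ ─′ b ⟫ ∣
    f₃ = ∣ ⟪ x ─′ gs ⟫ ∣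

    ∣X─A∣ : ∣ ⟪ x ─′ a ⟫ ∣ ≡ f₁ + f₃
    ∣X─A∣ = trans (∣p∣≡∣p∩q∣+∣p─q∣ ⟪ x ─′ a ⟫ ⟪ gs ⟫)
                  (cong₂ _+_ (cong ∣_∣ ((x ─′ a) ∩′ gs ≐ xˢ ─′ a)) (cong ∣_∣ (x ─′ a ─′ gs ≐ x ─′ gs)))

    ∣Xᴶ─B∣ : ∣ ⟪ xᴶ ─′ b ⟫ ∣ ≡ f₂ + f₃
    ∣Xᴶ─B∣ = trans (∣p∣≡∣p∩q∣+∣p─q∣ ⟪ xᴶ ─′ b ⟫ ⟪ gs ⟫)
                   (cong₂ _+_ (cong ∣_∣ ((xᴶ ─′ b) ∩′ gs ≐ xᴺ ─′ b)) (cong ∣_∣ (xᴶ ─′ b ─′ gs ≐ x ─′ gs)))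

    π≤π′+f₃ : π ≤ π′ + f₃
    π≤π′+f₃ = begin
      π                                                ≡⟨ cong (rk P) (xᴶ ∩′ c ≐ (xᴺ ∩′ (v ∩′ c)) ∪′ ((x ∩′ c) ─′ gs)) ⟩
      rk P ⟪ (xᴺ ∩′ (v ∩′ c)) ∪′ ((x ∩′ c) ─′ gs) ⟫ ≤⟨ rk[S∪T]≤rk[S]+∣T∣ P-matroid (⊆-by (xᴺ ∩′ (v ∩′ c)) c) (⊆-by ((x ∩′ c) ─′ gs) c) ⟩
      π′ + ∣ ⟪ (x ∩′ c) ─′ gs ⟫ ∣                     ≤⟨ +-monoʳ-≤ π′ (p⊆q⇒∣p∣≤∣q∣ (⊆-by ((x ∩′ c) ─′ gs) (x ─′ gs))) ⟩
      π′ + f₃                                          ∎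

    S-at-X : rk S ⟪ xˢ ⟫ ≡ (α + f₁) ⊓ (((β + f₂) ⊓ (π′ + ν)) + μ)
    S-at-X = cong₂ _⊓_ (cong (λ s → rk M s + f₁) (xˢ ∩′ a ≐ x ∩′ a))
                       (cong₂ _+_ (cong₂ (λ s t → (rk N s + f₂) ⊓ (π′ + rk N t))
                                         (xᴺ ∩′ b ≐ xᴶ ∩′ b) (b ─′ v ∩′ c ≐ b ─′ c))
                                  (cong (rk M) (a ─′ gn ≐ a ─′ (b ∪′ c))))

    N″-off-C : rk (N ⋈ (P ∣ V)) ⟪ w ∩′ gn ⟫ ≡ ν
    N″-off-C = begin-equality
      rk (N ⋈ (P ∣ V)) ⟪ w ∩′ gn ⟫
        ≡⟨ cong₂ _⊓_ (cong₂ (λ s t → rk N s + ∣ t ∣) ((w ∩′ gn) ∩′ b ≐ b ─′ c) ((w ∩′ gn) ─′ b ≐ ∅′))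
                     (cong₂ (λ s t → rk P s + rk N t) ((w ∩′ gn) ∩′ (v ∩′ c) ≐ ∅′) (b ─′ v ∩′ c ≐ b ─′ c)) ⟩
      (ν + ∣ ⊥ {n} ∣) ⊓ (rk P ⊥ + ν) ≡⟨ cong₂ (λ s t → (ν + s) ⊓ (t + ν)) (∣⊥∣≡0 n) (rk-⊥ P-matroid) ⟩
      (ν + 0) ⊓ ν                ≡⟨ cong (_⊓ ν) (+-identityʳ ν) ⟩
      ν ⊓ ν                      ≡⟨ ⊓-idem ν ⟩
      ν                          ∎

    S-off-C : rk S ⟪ w ⟫ ≡ (γ + e) ⊓ (ν + μ)
    S-off-C = cong₂ _⊓_ (cong₂ (λ s t → rk M s + ∣ t ∣) (w ∩′ a ≐ a ─′ c) (w ─′ a ≐ b ─′ c ─′ a))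
                        (cong₂ _+_ N″-off-C (cong (rk M) (a ─′ gn ≐ a ─′ (b ∪′ c))))

  splice-assoc : M ⋈ J ≅ S ⋈ P
  splice-assoc = ≅-intro ground-eq rk-eq

-- Of the matching hypotheses only Matched M (N ⋈ P) enters the rank computation;
-- the others are what make the splices matroids.
theorem6p2 : ∀ {n : ℕ} (M N P : SetFn n) →
    IsMatroid M → IsMatroid N → IsMatroid P →
    (Matched M N → Matched (M ⋈ N) P →
      ((M ⋈ N) ⋈ P) ≅ (M ⋈ ((M ∙ (ground M ∩ (ground N ∪ ground P)) ⋈ N) ⋈ P)))
    ×
    (Matched N P → Matched M (N ⋈ P) →
      (M ⋈ (N ⋈ P)) ≅ ((M ⋈ (N ⋈ (P ∣ ((ground M ∪ ground N) ∩ ground P)))) ⋈ P))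
theorem6p2 M N P M-matroid N-matroid P-matroid =
  (λ _ _ → SpliceAssocˡ.splice-assoc M N P M-matroid) ,
  (λ _ matched → SpliceAssocʳ.splice-assoc M N P M-matroid N-matroid P-matroid matched)
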